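{- Let $\mathcal U$ be a unification algorithm satisfying renaming compatibility (for every renaming $\rho$ and unifiable equation $E$, $\mathcal U(\rho(E))=\rho(\mathcal U(E))$). Let $\mathcal D$ be an SLD-derivation ending with goal $G$ and $\mathcal D'$ an SLD-derivation ending with goal $G'$, and let $\alpha$ be a prenaming with $\alpha(G)=G'$ which is complete for $G$ and cumulative for $\mathcal D$ to $\mathcal D'$. Assume SLD steps $G\xrightarrow{\mathcal K:\sigma}H$ and $G'\xrightarrow{\mathcal K':\sigma'}H'$ in which atoms in the same positions of $G$ and $G'$ are selected and the input clauses $\mathcal K,\mathcal K'$ are variants, and assume $\sigma$ is a relevant mgu. Let $\lambda:=\mathrm{pren}(\mathcal K,\mathcal K')$. Then: (1) $\alpha\oplus\lambda$ is complete for $H$ and for $\sigma$; (2) $\alpha\oplus\lambda$ is cumulative for the extended derivation $\mathcal D\xrightarrow{\mathcal K:\sigma}H$ to $\mathcal D'\xrightarrow{\mathcal K':\sigma'}H'$; (3) $H'=(\alpha\oplus\lambda)(H)$ and $\sigma'=(\alpha\oplus\lambda)(\sigma)$.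
   Context: Terms are built from a countably infinite set $V$ of variables and function symbols; $\mathrm{vars}(t)$ is the set of variables of $t$. A substitution is a map $\theta$ from variables to terms with finite active domain $\mathrm{Dom}(\theta)=\{x:\theta(x)\neq x\}$, extended homomorphically to terms; $\mathrm{vars}(\theta)=\mathrm{Dom}(\theta)\cup\mathrm{vars}(\theta(\mathrm{Dom}(\theta)))$. A renaming is a bijective substitution mapping variables to variables. A prenaming is a substitution $\alpha$ mapping variables to variables together with a fixed finite set $C^+(\alpha)\supseteq\mathrm{Dom}(\alpha)$ (its relaxed core, possibly containing passive variables) on which $\alpha$ is injective; $R^+(\alpha)=\alpha(C^+(\alpha))$. $\alpha$ is complete for a term or substitution $t$ if $\mathrm{vars}(t)\subseteq C^+(\alpha)$. $\alpha$ is cumulative for $t_1$ to $t_2$ if $C^+(\alpha)\subseteq\mathrm{vars}(t_1)$ and $R^+(\alpha)\subseteq\mathrm{vars}(t_2)$. For prenamings $\alpha,\beta$ with disjoint relaxed cores and disjoint $R^+$, the sum $\alpha\oplus\beta$ is the prenaming with relaxed core $C^+(\alpha)\cup C^+(\beta)$ agreeing with $\alpha$ on $C^+(\alpha)$, with $\beta$ on $C^+(\beta)$, identity elsewhere. For terms $s,t$ such that $t$ arises from $s$ by an injective replacement of variables by variables, $\mathrm{pren}(s,t)$ is the unique prenaming $\alpha$ with $C^+(\alpha)=\mathrm{vars}(s)$ and $\alpha(s)=t$. $\mathrm{indom}(\alpha)=V\setminus(R^+(\alpha)\setminus C^+(\alpha))$; $\alpha$ is safe for $t$ if $\mathrm{vars}(t)\subseteq\mathrm{indom}(\alpha)$;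 $s,t$ are variants if $s=\alpha(t)$ for some prenaming safe for $t$. For a substitution $\sigma$ and prenaming $\alpha$ safe for $\sigma$, $\alpha(\sigma):=\{\alpha(x)/\alpha(\sigma(x)):x\in\mathrm{Dom}(\sigma)\}$. SLD-derivations: a goal is a sequence of atoms. An SLD step $G\xrightarrow{\mathcal K:\sigma}H$ with $G=(M,A,N)$ selects atom $A$, uses an input clause $\mathcal K=A_1\leftarrow B_1$, a variant of a program clause whose variables are disjoint from all variables of the derivation so far (standardization apart), $\sigma=\mathcal U(A,A_1)$, and $H=\sigma(M,B_1,N)$. The set of variables of a derivation is the union of the variables of all its goals, all its mgus and all its input clauses. An mgu $\sigma$ of $A,A_1$ is relevant if $\mathrm{vars}(\sigma)\subseteq\mathrm{vars}(A)\cup\mathrm{vars}(A_1)$. -}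

module Defs where

open import Data.Nat using (ℕ; _≟_)
open import Data.List using (List; []; _∷_; _++_; map; length)
open import Data.List.Relation.Unary.Any using (Any)
open import Data.List.Membership.Propositional using (_∈_; _∉_)
open import Data.List.Membership.DecPropositional _≟_ using (_∈?_)
open import Data.Product using (Σ; ∃; _×_; _,_)
open import Data.Sum using (_⊎_)
open import Data.Empty using (⊥)
open import Data.Unit using (⊤)
open import Relation.Nullary using (¬_; yes; no)
open import Relation.Binary.PropositionalEquality using (_≡_; _≢_)

-- Terms, atoms, clauses, goals.  Variables are natural numbers (the
-- countably infinite set V); function/predicate symbols are named by ℕ.

data Term : Set where
  var : ℕ → Term
  fn  : ℕ → List Term → Term

record Atom : Set where
  constructor atom
  field
    pred : ℕ
    args : List Term
open Atom public

record Clause : Set where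
  constructor _⇐_
  field
    head : Atom
    body : List Atom
open Clause public

Goal : Set
Goal = List Atom

Program : Set
Program = List Clause

data _occ_ (x : ℕ) : Term → Set where
  here   : x occ var x
  inside : ∀ {f ts} → Any (x occ_) ts → x occ fn f ts

_occA_ : ℕ → Atom → Set
x occA A = Any (x occ_) (args A)

_occG_ : ℕ → Goal → Set
x occG G = Any (x occA_) G

_occC_ : ℕ → Clause → Set
x occC K = x occA head K ⊎ x occG body K

mutual
  renT : (ℕ → ℕ) → Term → Term
  renT f (var x)   = var (f x)
  renT f (fn g ts) = fn g (renTs f ts)

  renTs : (ℕ → ℕ) → List Term → List Term
  renTs f []       = []
  renTs f (t ∷ ts) = renT f t ∷ renTs f ts

renA : (ℕ → ℕ) → Atom → Atom
renA f (atom p ts) = atom p (renTs f ts)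

renG : (ℕ → ℕ) → Goal → Goal
renG f = map (renA f)

renC : (ℕ → ℕ) → Clause → Clause
renC f (h ⇐ b) = renA f h ⇐ renG f b

record Subst : Set where
  field
    app  : ℕ → Term
    supp : List ℕ
    fin  : ∀ x → app x ≢ var x → x ∈ supp
open Subst public

_∈Dom_ : ℕ → Subst → Set
x ∈Dom σ = app σ x ≢ var x

_occS_ : ℕ → Subst → Set
x occS σ = x ∈Dom σ ⊎ (∃ λ y → y ∈Dom σ × x occ app σ y)

mutual
  subT : Subst → Term → Term
  subT σ (var x)   = app σ x
  subT σ (fn g ts) = fn g (subTs σ ts)

  subTs : Subst → List Term → List Term
  subTs σ []       = []
  subTs σ (t ∷ ts) = subT σ t ∷ subTs σ ts

subA : Subst → Atom → Atom
subA σ (atom p ts) = atom p (subTs σ ts)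

subG : Subst → Goal → Goal
subG σ = map (subA σ)

IsUnifier : Subst → Atom → Atom → Set
IsUnifier θ A B = subA θ A ≡ subA θ B

Unifiable : Atom → Atom → Set
Unifiable A B = ∃ λ θ → IsUnifier θ A B

IsMGU : Subst → Atom → Atom → Set
IsMGU σ A B = IsUnifier σ A B ×
  (∀ θ → IsUnifier θ A B → ∃ λ η → ∀ x → app θ x ≡ subT η (app σ x))

IsRelevantMGU : Subst → Atom → Atom → Set
IsRelevantMGU σ A B = IsMGU σ A B × (∀ x → x occS σ → x occA A ⊎ x occA B)

-- "σ' ≐ γ [ σ ] means σ' = γ(σ)" where γ(σ) := { γ(x)/γ(σ(x)) : x ∈ Dom(σ) }
-- (the substitution mapping γ(x) to γ(σ(x)) for x ∈ Dom σ, identity elsewhere)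

_≐_[_] : Subst → (ℕ → ℕ) → Subst → Set
σ' ≐ γ [ σ ] =
  (∀ x → x ∈Dom σ → app σ' (γ x) ≡ renT γ (app σ x)) ×
  (∀ y → (∀ x → x ∈Dom σ → γ x ≢ y) → app σ' y ≡ var y)

IsRenaming : (ℕ → ℕ) → Set
IsRenaming ρ =
  (∀ x y → ρ x ≡ ρ y → x ≡ y) ×
  (∀ y → ∃ λ x → ρ x ≡ y) ×
  (∃ λ (d : List ℕ) → ∀ x → ρ x ≢ x → x ∈ d)

-- A unification algorithm returns an mgu for every unifiable equation A = B
-- (its value on non-unifiable equations is irrelevant).
record UnifAlg : Set where
  field
    U   : Atom → Atom → Subst
    mgu : ∀ A B → Unifiable A B → IsMGU (U A B) A B
open UnifAlg public

RenamingCompatible : UnifAlg → Set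
RenamingCompatible 𝒰 =
  ∀ ρ → IsRenaming ρ → ∀ A B → Unifiable A B →
    U 𝒰 (renA ρ A) (renA ρ B) ≐ ρ [ U 𝒰 A B ]

-- Prenamings (a variable map with a relaxed core C⁺)

record Pren : Set where
  constructor pren
  field
    fun  : ℕ → ℕ
    core : List ℕ
open Pren public

IsPrenaming : Pren → Set
IsPrenaming α =
  (∀ x → fun α x ≢ x → x ∈ core α) ×
  (∀ x y → x ∈ core α → y ∈ core α → fun α x ≡ fun α y → x ≡ y)

rng : Pren → List ℕ
rng α = map (fun α) (core α)

_∈indom_ : ℕ → Pren → Set
x ∈indom α = ¬ (x ∈ rng α × x ∉ core α)

SafeC : Pren → Clause → Set
SafeC α K = ∀ x → x occC K → x ∈indom α

VariantC : Clause → Clause → Set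
VariantC K L = ∃ λ α → IsPrenaming α × SafeC α L × K ≡ renC (fun α) L

IsPrenOf : Pren → Clause → Clause → Set
IsPrenOf λ' K K' =
  IsPrenaming λ' × (∀ x → (x ∈ core λ' → x occC K) × (x occC K → x ∈ core λ')) ×
  renC (fun λ') K ≡ K'

-- α ⊕ β (raw; a prenaming when cores and R⁺ are disjoint)
_⊕_ : Pren → Pren → Pren
α ⊕ β = pren f (core α ++ core β)
  where
  f : ℕ → ℕ
  f x with x ∈? core α
  ... | yes _ = fun α x
  ... | no  _ = fun β x

Disjoint : List ℕ → List ℕ → Set
Disjoint xs ys = ∀ x → x ∈ xs → x ∈ ys → ⊥

data Deriv : Set where
  start : Goal → Deriv
  step  : Deriv → (i : ℕ) → (K : Clause) → (σ : Subst) → (H : Goal) → Deriv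
  -- step D i K σ H : D extended by an SLD step selecting the atom at
  -- position i of the last goal, with input clause K and mgu σ, giving H

lastG : Deriv → Goal
lastG (start G)        = G
lastG (step _ _ _ _ H) = H

_occD_ : ℕ → Deriv → Set
x occD start G        = x occG G
x occD step D _ K σ H = x occD D ⊎ x occC K ⊎ x occS σ ⊎ x occG H

SLDStep : UnifAlg → Goal → ℕ → Clause → Subst → Goal → Set
SLDStep 𝒰 G i K σ H =
  Σ Goal λ M → Σ Atom λ A → Σ Goal λ N →
    G ≡ M ++ (A ∷ N) × length M ≡ i × Unifiable A (head K) ×
    σ ≡ U 𝒰 A (head K) × H ≡ subG σ (M ++ body K ++ N)

ValidDeriv : Program → UnifAlg → Deriv → Set
ValidDeriv P 𝒰 (start G)        = ⊤
ValidDeriv P 𝒰 (step D i K σ H) =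
  ValidDeriv P 𝒰 D ×
  SLDStep 𝒰 (lastG D) i K σ H ×
  (∃ λ C → C ∈ P × VariantC K C) ×
  (∀ x → x occC K → ¬ x occD D)

CompleteG : Pren → Goal → Set
CompleteG α G = ∀ x → x occG G → x ∈ core α

CompleteS : Pren → Subst → Set
CompleteS α σ = ∀ x → x occS σ → x ∈ core α

Cumulative : Pren → Deriv → Deriv → Set
Cumulative α D D' = (∀ x → x ∈ core α → x occD D) × (∀ y → y ∈ rng α → y occD D')

module Submission where

-- Let γ = α ⊕ λ.  On its relaxed core C⁺(α) ∪ C⁺(λ) the map γ is
-- injective: α and λ are injective on their own cores, and standardization
-- apart (with cumulativity of α and λ(K) = K') makes both the two cores and
-- the two ranges disjoint.  Renaming compatibility of 𝒰, however, only speaks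
-- about genuine renamings, so γ is replaced by a finite permutation ρ of V
-- agreeing with γ on that core.  Since ρ(G) = G' and ρ(K) = K', the second
-- step is the ρ-image of the first (SLD steps commute with renamings).
-- Finally every variable of H and of the relevant mgu σ lies in vars(G) ∪
-- vars(K), hence in the core, where ρ and γ agree, so ρ may be replaced by γ.

open import Defs
open import Data.Nat using (ℕ; _≟_)
open import Data.Nat.Properties using (suc-injective)
open import Data.List using (List; []; _∷_; _++_; map; length)
open import Data.List.Properties using (map-++; length-map; ∷-injective)
open import Data.List.Relation.Unary.Any using (Any; here; there)
import Data.List.Relation.Unary.Any.Properties as Any
open import Data.List.Membership.Propositional using (_∈_; _∉_)
import Data.List.Membership.Propositional.Properties as Mem
open import Data.List.Membership.DecPropositional _≟_ using (_∈?_)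
open import Data.Product using (∃; _×_; _,_; proj₁; proj₂)
open import Data.Sum using (_⊎_; inj₁; inj₂)
open import Data.Empty using (⊥-elim)
open import Relation.Nullary using (¬_; yes; no)
open import Relation.Binary.PropositionalEquality
open ≡-Reasoning

mutual
  renT-cong : ∀ {f g} t → (∀ x → x occ t → f x ≡ g x) → renT f t ≡ renT g t
  renT-cong (var x)   agree = cong var (agree x here)
  renT-cong (fn k ts) agree = cong (fn k) (renTs-cong ts (λ x p → agree x (inside p)))

  renTs-cong : ∀ {f g} ts → (∀ x → Any (x occ_) ts → f x ≡ g x) →
               renTs f ts ≡ renTs g ts
  renTs-cong []       agree = refl
  renTs-cong (t ∷ ts) agree =
    cong₂ _∷_ (renT-cong t (λ x p → agree x (here p)))
              (renTs-cong ts (λ x p → agree x (there p)))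

renA-cong : ∀ {f g} A → (∀ x → x occA A → f x ≡ g x) → renA f A ≡ renA g A
renA-cong (atom p ts) agree = cong (atom p) (renTs-cong ts agree)

renG-cong : ∀ {f g} G → (∀ x → x occG G → f x ≡ g x) → renG f G ≡ renG g G
renG-cong []      agree = refl
renG-cong (A ∷ G) agree =
  cong₂ _∷_ (renA-cong A (λ x p → agree x (here p)))
            (renG-cong G (λ x p → agree x (there p)))

renC-cong : ∀ {f g} K → (∀ x → x occC K → f x ≡ g x) → renC f K ≡ renC g K
renC-cong (h ⇐ b) agree =
  cong₂ _⇐_ (renA-cong h (λ x p → agree x (inj₁ p)))
            (renG-cong b (λ x p → agree x (inj₂ p)))

mutual
  occ-ren : ∀ f {x} t → x occ t → f x occ renT f t
  occ-ren f (var x)   here       = here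
  occ-ren f (fn k ts) (inside p) = inside (occs-ren f ts p)

  occs-ren : ∀ f {x} ts → Any (x occ_) ts → Any (f x occ_) (renTs f ts)
  occs-ren f (t ∷ ts) (here p)  = here (occ-ren f t p)
  occs-ren f (t ∷ ts) (there p) = there (occs-ren f ts p)

occA-ren : ∀ f {x} A → x occA A → f x occA renA f A
occA-ren f (atom p ts) = occs-ren f ts

occG-ren : ∀ f {x} G → x occG G → f x occG renG f G
occG-ren f (A ∷ G) (here p)  = here (occA-ren f A p)
occG-ren f (A ∷ G) (there p) = there (occG-ren f G p)

occC-ren : ∀ f {x} K → x occC K → f x occC renC f K
occC-ren f (h ⇐ b) (inj₁ p) = inj₁ (occA-ren f h p)
occC-ren f (h ⇐ b) (inj₂ p) = inj₂ (occG-ren f b p)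

mutual
  occ-sub : ∀ σ {x} t → x occ subT σ t → ∃ λ y → y occ t × x occ app σ y
  occ-sub σ (var y)   p = y , here , p
  occ-sub σ (fn k ts) (inside p) with occs-sub σ ts p
  ... | y , q , r = y , inside q , r

  occs-sub : ∀ σ {x} ts → Any (x occ_) (subTs σ ts) →
             ∃ λ y → Any (y occ_) ts × x occ app σ y
  occs-sub σ (t ∷ ts) (here p) with occ-sub σ t p
  ... | y , q , r = y , here q , r
  occs-sub σ (t ∷ ts) (there p) with occs-sub σ ts p
  ... | y , q , r = y , there q , r

occA-sub : ∀ σ {x} A → x occA subA σ A → ∃ λ y → y occA A × x occ app σ y
occA-sub σ (atom p ts) = occs-sub σ ts

occG-sub : ∀ σ {x} G → x occG subG σ G → ∃ λ y → y occG G × x occ app σ y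
occG-sub σ (A ∷ G) (here p) with occA-sub σ A p
... | y , q , r = y , here q , r
occG-sub σ (A ∷ G) (there p) with occG-sub σ G p
... | y , q , r = y , there q , r

fixed-or-dom : ∀ σ y → app σ y ≡ var y ⊎ y ∈Dom σ
fixed-or-dom σ y with app σ y
... | fn _ _ = inj₂ (λ ())
... | var z with z ≟ y
...   | yes refl = inj₁ refl
...   | no  z≢y  = inj₂ (λ { refl → z≢y refl })

occG-subst : ∀ σ {x} G → x occG subG σ G → x occG G ⊎ x occS σ
occG-subst σ {x} G p with occG-sub σ G p
... | y , y∈G , x∈σy with fixed-or-dom σ y
...   | inj₂ y∈dom = inj₂ (inj₂ (y , y∈dom , x∈σy))
...   | inj₁ σy≡y with subst (x occ_) σy≡y x∈σy
...     | here = inj₁ y∈G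

mutual
  subT-renT : ∀ {σ' σ ρ} → (∀ x → app σ' (ρ x) ≡ renT ρ (app σ x)) →
              ∀ t → subT σ' (renT ρ t) ≡ renT ρ (subT σ t)
  subT-renT comm (var x)   = comm x
  subT-renT comm (fn k ts) = cong (fn k) (subTs-renTs comm ts)

  subTs-renTs : ∀ {σ' σ ρ} → (∀ x → app σ' (ρ x) ≡ renT ρ (app σ x)) →
                ∀ ts → subTs σ' (renTs ρ ts) ≡ renTs ρ (subTs σ ts)
  subTs-renTs comm []       = refl
  subTs-renTs comm (t ∷ ts) = cong₂ _∷_ (subT-renT comm t) (subTs-renTs comm ts)

subG-renG : ∀ {σ' σ ρ} → (∀ x → app σ' (ρ x) ≡ renT ρ (app σ x)) →
            ∀ G → subG σ' (renG ρ G) ≡ renG ρ (subG σ G)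
subG-renG comm []              = refl
subG-renG comm (atom p ts ∷ G) =
  cong₂ _∷_ (cong (atom p) (subTs-renTs comm ts)) (subG-renG comm G)

-- For injective ρ, σ' = ρ(σ) means σ' ∘ ρ = ρ ∘ σ on all variables
-- (off Dom(σ) both sides are the variable ρ x).
≐-pointwise : ∀ {σ' σ ρ} → (∀ x y → ρ x ≡ ρ y → x ≡ y) → σ' ≐ ρ [ σ ] →
              ∀ x → app σ' (ρ x) ≡ renT ρ (app σ x)
≐-pointwise {σ' = σ'} {σ} {ρ} inj (onDom , offDom) x with fixed-or-dom σ x
... | inj₂ x∈dom = onDom x x∈dom
... | inj₁ σx≡x  = begin
  app σ' (ρ x)      ≡⟨ offDom (ρ x) (λ z z∈dom ρz≡ρx → z∈dom (fixed z (inj z x ρz≡ρx))) ⟩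
  var (ρ x)         ≡⟨ cong (renT ρ) (sym σx≡x) ⟩
  renT ρ (app σ x)  ∎
  where
  fixed : ∀ z → z ≡ x → app σ z ≡ var z
  fixed z refl = σx≡x

≐-agree : ∀ {σ' σ ρ γ} → (∀ x → x occS σ → ρ x ≡ γ x) →
          σ' ≐ ρ [ σ ] → σ' ≐ γ [ σ ]
≐-agree {σ'} {σ} {ρ} {γ} agree (onDom , offDom) = onDom' , offDom'
  where
  onDom' : ∀ x → x ∈Dom σ → app σ' (γ x) ≡ renT γ (app σ x)
  onDom' x x∈dom = begin
    app σ' (γ x)      ≡⟨ cong (app σ') (sym (agree x (inj₁ x∈dom))) ⟩
    app σ' (ρ x)      ≡⟨ onDom x x∈dom ⟩
    renT ρ (app σ x)  ≡⟨ renT-cong (app σ x) (λ y p → agree y (inj₂ (x , x∈dom , p))) ⟩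
    renT γ (app σ x)  ∎

  offDom' : ∀ y → (∀ x → x ∈Dom σ → γ x ≢ y) → app σ' y ≡ var y
  offDom' y notImage =
    offDom y (λ x x∈dom ρx≡y → notImage x x∈dom (trans (sym (agree x (inj₁ x∈dom))) ρx≡y))

split-unique : ∀ {A : Set} (xs ys : List A) {a b : A} {zs ws : List A} →
               length xs ≡ length ys → xs ++ a ∷ zs ≡ ys ++ b ∷ ws →
               xs ≡ ys × a ≡ b × zs ≡ ws
split-unique []       []       _   eq = refl , ∷-injective eq
split-unique []       (_ ∷ _)  ()  _
split-unique (_ ∷ _)  []       ()  _
split-unique (x ∷ xs) (y ∷ ys) len eq with ∷-injective eq
... | x≡y , rest with split-unique xs ys (suc-injective len) rest
...   | xs≡ys , a≡b , zs≡ws = cong₂ _∷_ x≡y xs≡ys , a≡b , zs≡ws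

transpose : ℕ → ℕ → ℕ → ℕ
transpose a b x with x ≟ a
... | yes _ = b
... | no  _ with x ≟ b
...   | yes _ = a
...   | no  _ = x

transpose-a : ∀ a b → transpose a b a ≡ b
transpose-a a b with a ≟ a
... | yes _  = refl
... | no a≢a = ⊥-elim (a≢a refl)

transpose-b : ∀ a b → transpose a b b ≡ a
transpose-b a b with b ≟ a
... | yes b≡a = b≡a
... | no  _ with b ≟ b
...   | yes _  = refl
...   | no b≢b = ⊥-elim (b≢b refl)

transpose-other : ∀ a b x → x ≢ a → x ≢ b → transpose a b x ≡ x
transpose-other a b x x≢a x≢b with x ≟ a
... | yes x≡a = ⊥-elim (x≢a x≡a)
... | no  _ with x ≟ b
...   | yes x≡b = ⊥-elim (x≢b x≡b)
...   | no  _   = refl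

transpose-involutive : ∀ a b x → transpose a b (transpose a b x) ≡ x
transpose-involutive a b x with x ≟ a
... | yes refl = transpose-b x b
... | no  x≢a with x ≟ b
...   | yes refl = transpose-a a x
...   | no  x≢b  = transpose-other a b x x≢a x≢b

transpose-support : ∀ a b x → transpose a b x ≢ x → x ∈ a ∷ b ∷ []
transpose-support a b x moved with x ≟ a
... | yes x≡a = here x≡a
... | no  _ with x ≟ b
...   | yes x≡b = there (here x≡b)
...   | no  _   = ⊥-elim (moved refl)

record FinPerm : Set where
  field
    to        : ℕ → ℕ
    from      : ℕ → ℕ
    from-to   : ∀ x → from (to x) ≡ x
    to-from   : ∀ x → to (from x) ≡ x
    support   : List ℕ
    supported : ∀ x → to x ≢ x → x ∈ support
open FinPerm

idPerm : FinPerm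
idPerm = record
  { to = λ x → x ; from = λ x → x ; from-to = λ _ → refl ; to-from = λ _ → refl
  ; support = [] ; supported = λ x moved → ⊥-elim (moved refl) }

transposeAfter : ℕ → ℕ → FinPerm → FinPerm
transposeAfter a b π = record
  { to        = λ x → transpose a b (to π x)
  ; from      = λ x → from π (transpose a b x)
  ; from-to   = λ x → trans (cong (from π) (transpose-involutive a b (to π x))) (from-to π x)
  ; to-from   = λ x → trans (cong (transpose a b) (to-from π (transpose a b x)))
                            (transpose-involutive a b x)
  ; support   = a ∷ b ∷ support π
  ; supported = supported'
  }
  where
  supported' : ∀ x → transpose a b (to π x) ≢ x → x ∈ a ∷ b ∷ support π
  supported' x moved with to π x ≟ x
  ... | no πx≢x  = there (there (supported π x πx≢x))
  ... | yes πx≡x with transpose-support a b x (λ τx≡x → moved (trans (cong (transpose a b) πx≡x) τx≡x))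
  ...   | here x≡a         = here x≡a
  ...   | there (here x≡b) = there (here x≡b)

to-injective : ∀ π x y → to π x ≡ to π y → x ≡ y
to-injective π x y eq = trans (sym (from-to π x)) (trans (cong (from π) eq) (from-to π y))

InjectiveOn : (ℕ → ℕ) → List ℕ → Set
InjectiveOn γ xs = ∀ x y → x ∈ xs → y ∈ xs → γ x ≡ γ y → x ≡ y

-- Realise γ on cs by successive transpositions: after realising γ on cs,
-- exchange the current image of c with γ c.
permOf : (ℕ → ℕ) → List ℕ → FinPerm
permOf γ []       = idPerm
permOf γ (c ∷ cs) = transposeAfter (to (permOf γ cs) c) (γ c) (permOf γ cs)

-- If γ is injective on cs, then permOf γ cs agrees with γ on cs: the new
-- transposition cannot disturb the earlier values γ d, d ≠ c, by injectivity.
permOf-agrees : ∀ γ cs → InjectiveOn γ cs → ∀ d → d ∈ cs → to (permOf γ cs) d ≡ γ d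
permOf-agrees γ (c ∷ cs) inj .c (here refl) = transpose-a (to (permOf γ cs) c) (γ c)
permOf-agrees γ (c ∷ cs) inj d (there d∈cs) with d ≟ c
... | yes refl = transpose-a (to (permOf γ cs) d) (γ d)
... | no  d≢c  = begin
  transpose (to π c) (γ c) (to π d)  ≡⟨ cong (transpose (to π c) (γ c)) πd≡γd ⟩
  transpose (to π c) (γ c) (γ d)     ≡⟨ transpose-other (to π c) (γ c) (γ d)
                                          (λ e → d≢c (to-injective π d c (trans πd≡γd e)))
                                          (λ e → d≢c (inj d c (there d∈cs) (here refl) e)) ⟩
  γ d                                ∎
  where
  π : FinPerm
  π = permOf γ cs

  πd≡γd : to π d ≡ γ d
  πd≡γd = permOf-agrees γ cs (λ x y x∈ y∈ → inj x y (there x∈) (there y∈)) d d∈cs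

extendToRenaming : ∀ γ cs → InjectiveOn γ cs →
                   ∃ λ ρ → IsRenaming ρ × (∀ x → x ∈ cs → ρ x ≡ γ x)
extendToRenaming γ cs inj =
  to π , (to-injective π , (λ y → from π y , to-from π y) , (support π , supported π)) ,
  permOf-agrees γ cs inj
  where π = permOf γ cs

resolventVars : ∀ {𝒰 G i K σ H} → SLDStep 𝒰 G i K σ H →
                (∀ x → x occS σ → x occG G ⊎ x occC K) →
                ∀ x → x occG H → x occG G ⊎ x occC K
resolventVars {K = K} {σ = σ} (M , A , N , refl , _ , _ , _ , refl) covered x x∈H
  with occG-subst σ (M ++ body K ++ N) x∈H
... | inj₂ x∈σ = covered x x∈σ
... | inj₁ x∈MBN with Any.++⁻ M x∈MBN
...   | inj₁ x∈M = inj₁ (Any.++⁺ˡ x∈M)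
...   | inj₂ x∈BN with Any.++⁻ (body K) x∈BN
...     | inj₁ x∈B = inj₂ (inj₂ x∈B)
...     | inj₂ x∈N = inj₁ (Any.++⁺ʳ M (there x∈N))

relevantVars : ∀ {𝒰 G i K σ H} → SLDStep 𝒰 G i K σ H →
               (∀ M A N → G ≡ M ++ (A ∷ N) → length M ≡ i → IsRelevantMGU σ A (head K)) →
               ∀ x → x occS σ → x occG G ⊎ x occC K
relevantVars (M , A , N , refl , lenM , _) relevant x x∈σ
  with proj₂ (relevant M A N refl lenM) x x∈σ
... | inj₁ x∈A = inj₁ (Any.++⁺ʳ M (here x∈A))
... | inj₂ x∈h = inj₂ (inj₁ x∈h)

renameStep : ∀ {𝒰 G G' i K K' σ σ' H H'} → RenamingCompatible 𝒰 →
             ∀ ρ → IsRenaming ρ → renG ρ G ≡ G' → renC ρ K ≡ K' →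
             SLDStep 𝒰 G i K σ H → SLDStep 𝒰 G' i K' σ' H' →
             σ' ≐ ρ [ σ ] × H' ≡ renG ρ H
renameStep {𝒰} {K = hK ⇐ bK} rc ρ ρ-ren refl refl
  (M , A , N , refl , lenM , unifiable , refl , refl)
  (M' , A' , N' , splitG' , lenM' , _ , refl , refl) = σ'≐ρσ , resolvent
  where
  parts : renG ρ M ≡ M' × renA ρ A ≡ A' × renG ρ N ≡ N'
  parts = split-unique (renG ρ M) M' (trans (length-map (renA ρ) M) (trans lenM (sym lenM')))
                       (trans (sym (map-++ (renA ρ) M (A ∷ N))) splitG')

  σ'≐ρσ : U 𝒰 A' (renA ρ hK) ≐ ρ [ U 𝒰 A hK ]
  σ'≐ρσ = subst (λ B → U 𝒰 B (renA ρ hK) ≐ ρ [ U 𝒰 A hK ]) (proj₁ (proj₂ parts))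
                (rc ρ ρ-ren A hK unifiable)

  commutes : ∀ x → app (U 𝒰 A' (renA ρ hK)) (ρ x) ≡ renT ρ (app (U 𝒰 A hK) x)
  commutes = ≐-pointwise {σ' = U 𝒰 A' (renA ρ hK)} {σ = U 𝒰 A hK} (proj₁ ρ-ren) σ'≐ρσ

  renamedBody : renG ρ (M ++ bK ++ N) ≡ M' ++ renG ρ bK ++ N'
  renamedBody = begin
    renG ρ (M ++ bK ++ N)             ≡⟨ map-++ (renA ρ) M (bK ++ N) ⟩
    renG ρ M ++ renG ρ (bK ++ N)      ≡⟨ cong (renG ρ M ++_) (map-++ (renA ρ) bK N) ⟩
    renG ρ M ++ renG ρ bK ++ renG ρ N ≡⟨ cong₂ (λ L R → L ++ renG ρ bK ++ R)
                                                (proj₁ parts) (proj₂ (proj₂ parts)) ⟩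
    M' ++ renG ρ bK ++ N'             ∎

  resolvent : subG (U 𝒰 A' (renA ρ hK)) (M' ++ renG ρ bK ++ N') ≡
              renG ρ (subG (U 𝒰 A hK) (M ++ bK ++ N))
  resolvent = begin
    subG (U 𝒰 A' (renA ρ hK)) (M' ++ renG ρ bK ++ N')  ≡⟨ cong (subG (U 𝒰 A' (renA ρ hK))) (sym renamedBody) ⟩
    subG (U 𝒰 A' (renA ρ hK)) (renG ρ (M ++ bK ++ N))  ≡⟨ subG-renG commutes (M ++ bK ++ N) ⟩
    renG ρ (subG (U 𝒰 A hK) (M ++ bK ++ N))            ∎

⊕-left : ∀ α β x → x ∈ core α → fun (α ⊕ β) x ≡ fun α x
⊕-left α β x x∈α with x ∈? core α
... | yes _  = refl
... | no x∉α = ⊥-elim (x∉α x∈α)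

⊕-right : ∀ α β x → x ∉ core α → fun (α ⊕ β) x ≡ fun β x
⊕-right α β x x∉α with x ∈? core α
... | yes x∈α = ⊥-elim (x∉α x∈α)
... | no  _   = refl

module _ (α β : Pren) (cores : Disjoint (core α) (core β)) where

  ⊕-right-core : ∀ x → x ∈ core β → fun (α ⊕ β) x ≡ fun β x
  ⊕-right-core x x∈β = ⊕-right α β x (λ x∈α → cores x x∈α x∈β)

  module _ (ranges : Disjoint (rng α) (rng β)) where

    ⊕-separates : ∀ {x y} → x ∈ core α → y ∈ core β → fun (α ⊕ β) x ≢ fun (α ⊕ β) y
    ⊕-separates {x} {y} x∈α y∈β eq =
      ranges (fun α x) (Mem.∈-map⁺ (fun α) x∈α)
        (subst (_∈ rng β) (trans (sym (⊕-right-core y y∈β)) (trans (sym eq) (⊕-left α β x x∈α)))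
               (Mem.∈-map⁺ (fun β) y∈β))

    ⊕-injective : IsPrenaming α → IsPrenaming β → InjectiveOn (fun (α ⊕ β)) (core (α ⊕ β))
    ⊕-injective (_ , α-inj) (_ , β-inj) x y x∈ y∈ eq
      with Mem.∈-++⁻ (core α) x∈ | Mem.∈-++⁻ (core α) y∈
    ... | inj₁ x∈α | inj₁ y∈α =
      α-inj x y x∈α y∈α (trans (sym (⊕-left α β x x∈α)) (trans eq (⊕-left α β y y∈α)))
    ... | inj₂ x∈β | inj₂ y∈β =
      β-inj x y x∈β y∈β (trans (sym (⊕-right-core x x∈β)) (trans eq (⊕-right-core y y∈β)))
    ... | inj₁ x∈α | inj₂ y∈β = ⊥-elim (⊕-separates x∈α y∈β eq)
    ... | inj₂ x∈β | inj₁ y∈α = ⊥-elim (⊕-separates y∈α x∈β (sym eq))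

  ⊕-rng : ∀ y → y ∈ rng (α ⊕ β) → y ∈ rng α ⊎ y ∈ rng β
  ⊕-rng y y∈ with Mem.∈-map⁻ (fun (α ⊕ β)) y∈
  ... | x , x∈ , y≡ with Mem.∈-++⁻ (core α) x∈
  ...   | inj₁ x∈α = inj₁ (subst (_∈ rng α) (sym (trans y≡ (⊕-left α β x x∈α))) (Mem.∈-map⁺ (fun α) x∈α))
  ...   | inj₂ x∈β = inj₂ (subst (_∈ rng β) (sym (trans y≡ (⊕-right-core x x∈β))) (Mem.∈-map⁺ (fun β) x∈β))

⊕-complete : ∀ α β {G K} → CompleteG α G → (∀ x → x occC K → x ∈ core β) →
             ∀ x → x occG G ⊎ x occC K → x ∈ core (α ⊕ β)
⊕-complete α β compG compK x (inj₁ x∈G) = Mem.∈-++⁺ˡ (compG x x∈G)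
⊕-complete α β compG compK x (inj₂ x∈K) = Mem.∈-++⁺ʳ (core α) (compK x x∈K)

rng-occurs : ∀ λ' {K K'} → (∀ x → x ∈ core λ' → x occC K) → renC (fun λ') K ≡ K' →
             ∀ y → y ∈ rng λ' → y occC K'
rng-occurs λ' {K} inK refl y y∈ with Mem.∈-map⁻ (fun λ') y∈
... | x , x∈ , refl = occC-ren (fun λ') K (inK x x∈)

apart-disjoint : ∀ {D K} {xs ys : List ℕ} → (∀ x → x occC K → ¬ x occD D) →
                 (∀ x → x ∈ xs → x occD D) → (∀ x → x ∈ ys → x occC K) → Disjoint xs ys
apart-disjoint fresh inD inK x x∈xs x∈ys = fresh x (inK x x∈ys) (inD x x∈xs)

cumulative-step : ∀ {D D' i K K' σ σ' H H'} α λ' → Disjoint (core α) (core λ') →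
                  Cumulative α D D' → (∀ x → x ∈ core λ' → x occC K) →
                  (∀ y → y ∈ rng λ' → y occC K') →
                  Cumulative (α ⊕ λ') (step D i K σ H) (step D' i K' σ' H')
cumulative-step {D} {D'} {i} {K} {K'} {σ} {σ'} {H} {H'} α λ' cores (coreD , rngD') inK inK' =
  coreStep , rngStep
  where
  coreStep : ∀ x → x ∈ core (α ⊕ λ') → x occD step D i K σ H
  coreStep x x∈ with Mem.∈-++⁻ (core α) x∈
  ... | inj₁ x∈α = inj₁ (coreD x x∈α)
  ... | inj₂ x∈λ = inj₂ (inj₁ (inK x x∈λ))

  rngStep : ∀ y → y ∈ rng (α ⊕ λ') → y occD step D' i K' σ' H'
  rngStep y y∈ with ⊕-rng α λ' cores y y∈
  ... | inj₁ y∈α = inj₁ (rngD' y y∈α)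
  ... | inj₂ y∈λ = inj₂ (inj₁ (inK' y y∈λ))

-- Renaming compatibility
-- applies only to genuine renamings, so α ⊕ λ is first replaced by a renaming ρ
-- agreeing with it on its core, which contains all variables of G, K, H and σ.
stepImage : ∀ {𝒰 G G' i K K' σ σ' H H'} → RenamingCompatible 𝒰 →
            ∀ α λ' → IsPrenaming α → IsPrenaming λ' →
            Disjoint (core α) (core λ') → Disjoint (rng α) (rng λ') →
            CompleteG α G → renG (fun α) G ≡ G' →
            (∀ x → x occC K → x ∈ core λ') → renC (fun λ') K ≡ K' →
            SLDStep 𝒰 G i K σ H → SLDStep 𝒰 G' i K' σ' H' →
            (∀ x → x occS σ → x occG G ⊎ x occC K) →
            H' ≡ renG (fun (α ⊕ λ')) H × σ' ≐ fun (α ⊕ λ') [ σ ]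
stepImage {𝒰} {G} {G'} {K = K} {K'} {σ} {σ'} {H} {H'}
          rc α λ' αP λP cores ranges compG αG compK λK sld sld' covered =
  trans H'≡ρH (renG-cong H (λ x x∈H → ρ≡γ x (inCore x (resolventVars {𝒰} sld covered x x∈H)))) ,
  ≐-agree {σ' = σ'} {σ = σ} (λ x x∈σ → ρ≡γ x (inCore x (covered x x∈σ))) σ'≐ρσ
  where
  γ : ℕ → ℕ
  γ = fun (α ⊕ λ')

  inCore : ∀ x → x occG G ⊎ x occC K → x ∈ core (α ⊕ λ')
  inCore = ⊕-complete α λ' {G} {K} compG compK

  extension : ∃ λ ρ → IsRenaming ρ × (∀ x → x ∈ core (α ⊕ λ') → ρ x ≡ γ x)
  extension = extendToRenaming γ (core (α ⊕ λ')) (⊕-injective α λ' cores ranges αP λP)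

  ρ : ℕ → ℕ
  ρ = proj₁ extension

  ρ≡γ : ∀ x → x ∈ core (α ⊕ λ') → ρ x ≡ γ x
  ρ≡γ = proj₂ (proj₂ extension)

  ρG : renG ρ G ≡ G'
  ρG = trans (renG-cong G (λ x x∈G → trans (ρ≡γ x (inCore x (inj₁ x∈G)))
                                           (⊕-left α λ' x (compG x x∈G)))) αG

  ρK : renC ρ K ≡ K'
  ρK = trans (renC-cong K (λ x x∈K → trans (ρ≡γ x (inCore x (inj₂ x∈K)))
                                           (⊕-right-core α λ' cores x (compK x x∈K)))) λK

  stepsρ : σ' ≐ ρ [ σ ] × H' ≡ renG ρ H
  stepsρ = renameStep {𝒰} rc ρ (proj₁ (proj₂ extension)) ρG ρK sld sld'

  σ'≐ρσ : σ' ≐ ρ [ σ ]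
  σ'≐ρσ = proj₁ stepsρ

  H'≡ρH : H' ≡ renG ρ H
  H'≡ρH = proj₂ stepsρ

mainTheorem2 : (P : Program) (𝒰 : UnifAlg) → RenamingCompatible 𝒰 →
    (D D' : Deriv) (α : Pren) → IsPrenaming α →
    renG (fun α) (lastG D) ≡ lastG D' →
    CompleteG α (lastG D) → Cumulative α D D' →
    (i : ℕ) (K K' : Clause) (σ σ' : Subst) (H H' : Goal) →
    ValidDeriv P 𝒰 (step D i K σ H) → ValidDeriv P 𝒰 (step D' i K' σ' H') →
    VariantC K K' →
    (∀ M A N → lastG D ≡ M ++ (A ∷ N) → length M ≡ i → IsRelevantMGU σ A (head K)) →
    (lam : Pren) → IsPrenOf lam K K' →
    (Disjoint (core α) (core lam) × Disjoint (rng α) (rng lam)) ×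
    (CompleteG (α ⊕ lam) H × CompleteS (α ⊕ lam) σ) ×
    Cumulative (α ⊕ lam) (step D i K σ H) (step D' i K' σ' H') ×
    (H' ≡ renG (fun (α ⊕ lam)) H × σ' ≐ fun (α ⊕ lam) [ σ ])
mainTheorem2 P 𝒰 rc D D' α αP αG compG cum i K K' σ σ' H H'
  (_ , sld , _ , freshK) (_ , sld' , _ , freshK') _ relevant lam (lamP , lamCore , lamK) =
  (cores , ranges) ,
  (completeH , completeσ) ,
  cumulative-step {D} {D'} {i} {K} {K'} {σ} {σ'} {H} {H'} α lam cores cum inK inK' ,
  stepImage {𝒰} rc α lam αP lamP cores ranges compG αG compK lamK sld sld' covered
  where
  inK : ∀ x → x ∈ core lam → x occC K
  inK x = proj₁ (lamCore x)
  compK : ∀ x → x occC K → x ∈ core lam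
  compK x = proj₂ (lamCore x)
  inK' : ∀ y → y ∈ rng lam → y occC K'
  inK' = rng-occurs lam inK lamK

  cores : Disjoint (core α) (core lam)
  cores = apart-disjoint {D} {K} freshK (proj₁ cum) inK

  ranges : Disjoint (rng α) (rng lam)
  ranges = apart-disjoint {D'} {K'} freshK' (proj₂ cum) inK'

  covered : ∀ x → x occS σ → x occG lastG D ⊎ x occC K
  covered = relevantVars {𝒰} sld relevant
  inCore : ∀ x → x occG lastG D ⊎ x occC K → x ∈ core (α ⊕ lam)
  inCore = ⊕-complete α lam {lastG D} {K} compG compK

  completeσ : CompleteS (α ⊕ lam) σ
  completeσ x x∈σ = inCore x (covered x x∈σ)

  completeH : CompleteG (α ⊕ lam) H
  completeH x x∈H = inCore x (resolventVars {𝒰} sld covered x x∈H)
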